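{- Let $G$ be a connected graph of order $n$ which is $k$-metric dimensional. If $n\ge 3$, then $2\le k\le n-1$. Moreover, $G$ is $n$-metric dimensional if and only if $G\cong K_2$.
   Context: For a connected graph $G=(V,E)$, $d_G(x,y)$ denotes the shortest-path distance. A vertex $w$ distinguishes two vertices $u,v$ if $d_G(u,w)\ne d_G(v,w)$. A set $S\subseteq V$ is a $k$-metric generator for $G$ if every pair of different vertices $u,v\in V$ is distinguished by at least $k$ elements of $S$. A $k$-metric generator of minimum cardinality is a $k$-metric basis, and its cardinality is the $k$-metric dimension $\dim_k(G)$. A connected graph $G$ is called $k$-metric dimensional if $k$ is the largest integer such that there exists a $k$-metric basis for $G$. -}

module Defs where

open import Data.Nat using (ℕ; zero; suc; _≤_)
open import Data.Fin using (Fin)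
open import Data.Fin.Subset using (Subset; _∈_; ∣_∣)
open import Data.Product using (Σ; ∃; _×_; _,_)
open import Data.Empty using (⊥)
open import Relation.Nullary using (¬_)
open import Relation.Binary.PropositionalEquality using (_≡_; _≢_)
open import Function.Definitions using (Injective)
open import Function.Bundles using (_↔_; Inverse)

record Graph (n : ℕ) : Set₁ where
  field
    Adj     : Fin n → Fin n → Set
    symAdj  : ∀ {u v} → Adj u v → Adj v u
    irrAdj  : ∀ {u} → ¬ Adj u u
open Graph public

data Walk {n : ℕ} (G : Graph n) : Fin n → Fin n → ℕ → Set where
  nil  : ∀ {u} → Walk G u u 0
  cons : ∀ {u v w m} → Adj G u v → Walk G v w m → Walk G u w (suc m)

Connected : ∀ {n} → Graph n → Set
Connected G = ∀ u v → ∃ λ m → Walk G u v m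

Dist : ∀ {n} → Graph n → Fin n → Fin n → ℕ → Set
Dist G u v m = Walk G u v m × (∀ m' → Walk G u v m' → m ≤ m')

Distinguishes : ∀ {n} → Graph n → Fin n → Fin n → Fin n → Set
Distinguishes G w u v = ∀ a b → Dist G u w a → Dist G v w b → a ≢ b

IsKMetricGenerator : ∀ {n} → Graph n → ℕ → Subset n → Set
IsKMetricGenerator {n} G k S =
  ∀ u v → u ≢ v →
    Σ (Fin k → Fin n) λ f → Injective _≡_ _≡_ f ×
      (∀ i → f i ∈ S × Distinguishes G (f i) u v)

IsKMetricBasis : ∀ {n} → Graph n → ℕ → Subset n → Set
IsKMetricBasis G k S =
  IsKMetricGenerator G k S × (∀ S' → IsKMetricGenerator G k S' → ∣ S ∣ ≤ ∣ S' ∣)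

KMetricDimensional : ∀ {n} → Graph n → ℕ → Set
KMetricDimensional G k =
  (∃ λ S → IsKMetricBasis G k S) ×
  (∀ k' → (∃ λ S → IsKMetricBasis G k' S) → k' ≤ k)

_≅_ : ∀ {n m} → Graph n → Graph m → Set
_≅_ {n} {m} G H =
  Σ (Fin n ↔ Fin m) λ φ →
    ∀ u v → (Adj G u v → Adj H (Inverse.to φ u) (Inverse.to φ v)) ×
            (Adj H (Inverse.to φ u) (Inverse.to φ v) → Adj G u v)

K : (n : ℕ) → Graph n
K n = record { Adj = λ u v → u ≢ v
             ; symAdj = λ p q → p (Relation.Binary.PropositionalEquality.sym q)
             ; irrAdj = λ p → p Relation.Binary.PropositionalEquality.refl }

-- Every vertex distinguishes itself from any other vertex, so the whole vertex
-- set is a 2-metric generator; since a largest k admitting a k-metric basis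
-- dominates every k' admitting a k'-metric generator, k ≥ 2. A connected graph
-- with at least three vertices has two distinct vertices u, v with a common
-- neighbour w; w does not distinguish u from v, so at most n − 1 vertices do and
-- k ≤ n − 1. Graphs with at most one vertex have k-metric bases for every k, so
-- only order 2 remains, where the connected graph is K₂ and is 2-metric
-- dimensional.
module Submission where

open import Defs
open import Data.Nat using (ℕ; zero; suc; _+_; _≤_; _<_; _∸_; z≤n; s≤s; _≤?_)
open import Data.Nat.Properties using (≤-<-trans; n≤0⇒n≡0; ≰⇒>; 1+n≰n)
open import Data.Nat.Induction using (<-rec)
open import Data.Fin using (Fin; zero; suc; punchOut; _≟_)
open import Data.Fin.Properties using (0≢1+n; suc-injective; injective⇒≤; punchOut-injective)
open import Data.Fin.Permutation using (↔⇒≡)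
open import Data.Fin.Subset using (Subset; _∈_; ∣_∣; ⊤; _-_)
open import Data.Fin.Subset.Properties using (∈⊤; x∈p∧x≢y⇒x∈p-y; x∈p⇒∣p-x∣<∣p∣)
open import Data.Product using (∃; _×_; _,_; proj₁; proj₂)
open import Data.Sum using (_⊎_; inj₁; inj₂)
open import Data.Empty using (⊥; ⊥-elim)
open import Relation.Nullary using (¬_; yes; no)
open import Relation.Nullary.Decidable using (decidable-stable)
open import Relation.Binary.PropositionalEquality using (_≡_; _≢_; refl; sym; trans; subst)
open import Function.Base using (_∘_)
open import Function.Definitions using (Injective)
open import Function.Bundles using (_⇔_; mk⇔)
open import Function.Construct.Identity using (↔-id)

¬¬-∃-minimal : ∀ {a p} {A : Set a} (μ : A → ℕ) (P : A → Set p) {x : A} → P x →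
  ¬ ¬ (∃ λ y → P y × (∀ z → P z → μ y ≤ μ z))
¬¬-∃-minimal μ P {x} px no-minimum = <-rec Refuted step (μ x) x refl px
  where
  Refuted : ℕ → Set _
  Refuted m = ∀ y → μ y ≡ m → P y → ⊥

  step : ∀ m → (∀ {m'} → m' < m → Refuted m') → Refuted m
  step _ refuted y refl py = no-minimum (y , py , minimal)
    where
    minimal : ∀ z → P z → μ y ≤ μ z
    minimal z pz = decidable-stable (μ y ≤? μ z)
      (λ μy≰μz → refuted (≰⇒> μy≰μz) z refl pz)

injective-into⇒≤∣S∣ : ∀ {k n} {f : Fin k → Fin n} (S : Subset n) →
  Injective _≡_ _≡_ f → (∀ i → f i ∈ S) → k ≤ ∣ S ∣
injective-into⇒≤∣S∣ {zero}  S _   _   = z≤n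
injective-into⇒≤∣S∣ {suc k} {f = f} S inj f∈S =
  ≤-<-trans (injective-into⇒≤∣S∣ (S - f zero) (suc-injective ∘ inj) f∘suc∈S-f₀)
            (x∈p⇒∣p-x∣<∣p∣ (f∈S zero))
  where
  f∘suc∈S-f₀ : ∀ i → f (suc i) ∈ S - f zero
  f∘suc∈S-f₀ i = x∈p∧x≢y⇒x∈p-y (f∈S (suc i)) (0≢1+n ∘ inj ∘ sym)

module _ {n : ℕ} {G : Graph n} where

  walk-length-0⇒≡ : ∀ {u v} → Walk G u v 0 → u ≡ v
  walk-length-0⇒≡ nil = refl

  dist-adjacent : ∀ {u v} → Adj G u v → Dist G u v 1
  dist-adjacent {u} {v} u-v = cons u-v nil , minimal
    where
    minimal : ∀ m → Walk G u v m → 1 ≤ m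
    minimal zero    nil = ⊥-elim (irrAdj G u-v)
    minimal (suc m) _   = s≤s z≤n

  distinguishes-sym : ∀ {w u v} → Distinguishes G w u v → Distinguishes G w v u
  distinguishes-sym D a b da db a≡b = D b a db da (sym a≡b)

  distinguishes-self : ∀ {u v} → u ≢ v → Distinguishes G u u v
  distinguishes-self {u} {v} u≢v a b (_ , a-minimal) (v⇝u , _) a≡b =
    u≢v (sym (walk-length-0⇒≡ (subst (Walk G v u) b≡0 v⇝u)))
    where
    b≡0 : b ≡ 0
    b≡0 = trans (sym a≡b) (n≤0⇒n≡0 (a-minimal 0 nil))

  ⊤-is2MetricGenerator : IsKMetricGenerator G 2 ⊤
  ⊤-is2MetricGenerator u v u≢v = f , f-injective , λ i → ∈⊤ , distinguishes i
    where
    f : Fin 2 → Fin n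
    f zero       = u
    f (suc zero) = v

    f-injective : Injective _≡_ _≡_ f
    f-injective {zero}     {zero}     _ = refl
    f-injective {zero}     {suc zero} e = ⊥-elim (u≢v e)
    f-injective {suc zero} {zero}     e = ⊥-elim (u≢v (sym e))
    f-injective {suc zero} {suc zero} _ = refl

    distinguishes : ∀ i → Distinguishes G (f i) u v
    distinguishes zero       = distinguishes-self u≢v
    distinguishes (suc zero) = distinguishes-sym (distinguishes-self (u≢v ∘ sym))

  generator⇒k≤∣S∣ : ∀ {k S} {u v : Fin n} → u ≢ v → IsKMetricGenerator G k S → k ≤ ∣ S ∣
  generator⇒k≤∣S∣ {S = S} u≢v gen with gen _ _ u≢v
  ... | f , f-injective , f∈S = injective-into⇒≤∣S∣ S f-injective (proj₁ ∘ f∈S)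

  -- A minimum-size generator exists only classically, but k' ≤ k is decidable.
  generator⇒≤dimension : ∀ {k k' S} → KMetricDimensional G k →
    IsKMetricGenerator G k' S → k' ≤ k
  generator⇒≤dimension {k} {k'} (_ , maximal) gen = decidable-stable (k' ≤? k)
    (λ k'≰k → ¬¬-∃-minimal ∣_∣ (IsKMetricGenerator G k') gen (k'≰k ∘ maximal k'))

  kMetricDimensional⇒2≤k : ∀ {k} → KMetricDimensional G k → 2 ≤ k
  kMetricDimensional⇒2≤k kmd = generator⇒≤dimension kmd ⊤-is2MetricGenerator

  ¬distinctVertices⇒¬kMetricDimensional : (∀ u v → u ≡ v) → ∀ {k} → ¬ KMetricDimensional G k
  ¬distinctVertices⇒¬kMetricDimensional all≡ kmd =
    1+n≰n (generator⇒≤dimension {S = ⊤} kmd (λ u v u≢v → ⊥-elim (u≢v (all≡ u v))))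

record Cherry {n : ℕ} (G : Graph n) : Set where
  constructor cherry
  field
    {left centre right} : Fin n
    left-centre  : Adj G left centre
    centre-right : Adj G centre right
    left≢right   : left ≢ right

module _ {n : ℕ} {G : Graph n} where

  cherry-¬distinguishes : (c : Cherry G) →
    ¬ Distinguishes G (Cherry.centre c) (Cherry.left c) (Cherry.right c)
  cherry-¬distinguishes (cherry l-c c-r _) D =
    D 1 1 (dist-adjacent l-c) (dist-adjacent (symAdj G c-r)) refl

  -- Either the walk's first two steps form a cherry, or they return to u.
  cherry-or-adjacent : ∀ {u v m} → Walk G u v m → u ≢ v → Cherry G ⊎ Adj G u v
  cherry-or-adjacent nil                      u≢u = ⊥-elim (u≢u refl)
  cherry-or-adjacent (cons u-v nil)           _   = inj₂ u-v
  cherry-or-adjacent {u} (cons {v = x} u-x (cons {v = y} x-y y⇝v)) u≢v with u ≟ y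
  ... | no  u≢y  = inj₁ (cherry u-x x-y u≢y)
  ... | yes refl = cherry-or-adjacent y⇝v u≢v

  connected-edge⇒cherry : Connected G → ∀ {a b c} → Adj G a b → c ≢ a → c ≢ b → Cherry G
  connected-edge⇒cherry con {a} {c = c} a-b c≢a c≢b
    with cherry-or-adjacent (proj₂ (con c a)) c≢a
  ... | inj₁ ch  = ch
  ... | inj₂ c-a = cherry c-a a-b c≢b

connected⇒cherry : ∀ {m} (G : Graph (3 + m)) → Connected G → Cherry G
connected⇒cherry G con with cherry-or-adjacent (proj₂ (con zero (suc zero))) (λ ())
... | inj₁ ch  = ch
... | inj₂ 0-1 = connected-edge⇒cherry con {c = suc (suc zero)} 0-1 (λ ()) (λ ())

cherry⇒generator-k≤n : ∀ {n k S} {G : Graph (suc n)} → Cherry G →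
  IsKMetricGenerator G k S → k ≤ n
cherry⇒generator-k≤n {n} {k} c gen with gen _ _ (Cherry.left≢right c)
... | f , f-injective , f∈S = injective⇒≤ f-avoiding-centre-injective
  where
  centre≢f : ∀ i → Cherry.centre c ≢ f i
  centre≢f i centre≡fi = cherry-¬distinguishes c
    (subst (λ w → Distinguishes _ w _ _) (sym centre≡fi) (proj₂ (f∈S i)))

  f-avoiding-centre : Fin k → Fin n
  f-avoiding-centre i = punchOut (centre≢f i)

  f-avoiding-centre-injective : Injective _≡_ _≡_ f-avoiding-centre
  f-avoiding-centre-injective = f-injective ∘ punchOut-injective (centre≢f _) (centre≢f _)

kMetricDimensional⇒k≤n∸1 : ∀ {n k} {G : Graph n} → Connected G → 3 ≤ n →
  KMetricDimensional G k → k ≤ n ∸ 1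
kMetricDimensional⇒k≤n∸1 {G = G} con (s≤s (s≤s (s≤s _))) ((_ , gen , _) , _) =
  cherry⇒generator-k≤n (connected⇒cherry G con) gen

order2⇒2MetricDimensional : (G : Graph 2) → KMetricDimensional G 2
order2⇒2MetricDimensional G = (⊤ , ⊤-is2MetricGenerator , minimal) , maximal
  where
  0≢1 : zero ≢ suc zero
  0≢1 ()

  minimal : ∀ S' → IsKMetricGenerator G 2 S' → ∣ ⊤ {2} ∣ ≤ ∣ S' ∣
  minimal _ = generator⇒k≤∣S∣ 0≢1

  maximal : ∀ k' → (∃ λ S → IsKMetricBasis G k' S) → k' ≤ 2
  maximal _ (_ , gen , _) with gen zero (suc zero) 0≢1
  ... | _ , f-injective , _ = injective⇒≤ f-injective

order2-connected⇒≅K2 : (G : Graph 2) → Connected G → G ≅ K 2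
order2-connected⇒≅K2 G con = ↔-id (Fin 2) , λ u v → adj⇒≢ , ≢⇒adj u v
  where
  adj⇒≢ : ∀ {u v} → Adj G u v → u ≢ v
  adj⇒≢ {u} u-v refl = irrAdj G u-v

  walk⇒adj : ∀ {m} → Walk G zero (suc zero) m → Adj G zero (suc zero)
  walk⇒adj (cons {v = zero}     0-0 _) = ⊥-elim (irrAdj G 0-0)
  walk⇒adj (cons {v = suc zero} 0-1 _) = 0-1

  ≢⇒adj : ∀ u v → u ≢ v → Adj G u v
  ≢⇒adj zero       zero       u≢v = ⊥-elim (u≢v refl)
  ≢⇒adj zero       (suc zero) _   = walk⇒adj (proj₂ (con zero (suc zero)))
  ≢⇒adj (suc zero) zero       _   = symAdj G (walk⇒adj (proj₂ (con zero (suc zero))))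
  ≢⇒adj (suc zero) (suc zero) u≢v = ⊥-elim (u≢v refl)

nMetricDimensional⇒≅K2 : ∀ n (G : Graph n) → Connected G → KMetricDimensional G n → G ≅ K 2
nMetricDimensional⇒≅K2 0 _ _ kmd = ⊥-elim (¬distinctVertices⇒¬kMetricDimensional (λ ()) kmd)
nMetricDimensional⇒≅K2 1 _ _ kmd =
  ⊥-elim (¬distinctVertices⇒¬kMetricDimensional (λ { zero zero → refl }) kmd)
nMetricDimensional⇒≅K2 2 G con _ = order2-connected⇒≅K2 G con
nMetricDimensional⇒≅K2 (suc (suc (suc _))) _ con kmd =
  ⊥-elim (1+n≰n (kMetricDimensional⇒k≤n∸1 con (s≤s (s≤s (s≤s z≤n))) kmd))

≅K2⇒nMetricDimensional : ∀ {n} {G : Graph n} → G ≅ K 2 → KMetricDimensional G n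
≅K2⇒nMetricDimensional {G = G} (φ , _) with refl ← ↔⇒≡ φ = order2⇒2MetricDimensional G

mainTheorem1 : ∀ (n : ℕ) (G : Graph n) → Connected G →
    (∀ k → KMetricDimensional G k → 3 ≤ n → 2 ≤ k × k ≤ n ∸ 1) ×
    (KMetricDimensional G n ⇔ G ≅ K 2)
mainTheorem1 n G con =
  (λ k kmd 3≤n → kMetricDimensional⇒2≤k kmd , kMetricDimensional⇒k≤n∸1 con 3≤n kmd) ,
  mk⇔ (nMetricDimensional⇒≅K2 n G con) ≅K2⇒nMetricDimensional
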